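{- Let $\Gamma = x_1\colon \mathrm{N}_{\mathrm{norm}},\dots,x_m\colon\mathrm{N}_{\mathrm{norm}},\; y_1\colon\mathrm{N}_{\mathrm{safe}},\dots,y_n\colon\mathrm{N}_{\mathrm{safe}}$ and suppose the $\mathsf{BCL}$ judgment $\Gamma\vdash e\colon \mathbf{b}$ is derivable, where $\mathbf{b}$ is a base type. (a) If $\mathbf{b}=\mathrm{N}_{\mathrm{norm}}$, then for all values (strings) assigned to $x_1,\dots,x_m,y_1,\dots,y_n$, the value $v$ of $e$ satisfies $|v|\le \max_{1\le i\le m}|x_i|$. (b) If $\mathbf{b}=\mathrm{N}_{\mathrm{safe}}$, then there is a polynomial $p$ in $|x_1|,\dots,|x_m|$ (with nonnegative coefficients) such that for all values assigned to $x_1,\dots,y_n$, the value $v$ of $e$ satisfies $|v|\le p(|x_1|,\dots,|x_m|)+\max_{1\le j\le n}|y_j|$.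
   Context: Natural numbers are identified with binary strings in $\{\mathbf 0,\mathbf 1\}^*$ via dyadic notation; $|v|$ is the length of the string $v$, $\epsilon$ the empty string, $a\oplus v$ concatenation; $\max\emptyset=0$. $\mathsf{BCL}$ raw expressions: $e::= k \mid (\mathsf c_{\mathbf 0}\,e)\mid(\mathsf c_{\mathbf 1}\,e)\mid(\mathsf d\,e)\mid(\mathsf t_{\mathbf 0}\,e)\mid(\mathsf t_{\mathbf 1}\,e)\mid(\mathsf{down}\,e\,e)\mid x\mid(e\,e)\mid(\lambda x.e)\mid(\mathsf{If}\,e\,\mathsf{then}\,e\,\mathsf{else}\,e)\mid(\mathsf{prn}\,e)$, where $k$ ranges over strings and all variables have base type. Types: the level-0 and level-1 simple types over the two base types $\mathrm N_{\mathrm{norm}},\mathrm N_{\mathrm{safe}}$, with subtyping generated by $\mathrm N_{\mathrm{norm}}<:\mathrm N_{\mathrm{safe}}$ and ($\sigma_1<:\sigma_0$ and $\tau_0<:\tau_1$) $\Rightarrow$ $\sigma_0\to\tau_0<:\sigma_1\to\tau_1$. Typing rules (contexts $\Gamma$ are finite maps from variables to types; $\Gamma_0\cup\Gamma_1$ is the union of consistent contexts): $\Gamma,x\colon\sigma\vdash x\colon\sigma$; from $\Gamma,x\colon\sigma\vdash e\colon\tau$ infer $\Gamma\vdash\lambda x.e\colon\sigma\to\tau$; from $\Gamma_0\vdash e_0\colon\sigma\to\tau$ and $\Gamma_1\vdash e_1\colon\sigma$ infer $\Gamma_0\cup\Gamma_1\vdash(e_0\,e_1)\colon\tau$; $\Gamma\vdash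 k\colon\mathrm N_{\mathrm{safe}}$ for each string constant $k$; $\Gamma\vdash\epsilon\colon\mathrm N_{\mathrm{norm}}$; from $\Gamma\vdash e\colon\mathrm N_{\mathrm{safe}}$ infer $\Gamma\vdash(\mathrm{op}\,e)\colon\mathrm N_{\mathrm{safe}}$ for $\mathrm{op}\in\{\mathsf c_{\mathbf0},\mathsf c_{\mathbf1},\mathsf d,\mathsf t_{\mathbf0},\mathsf t_{\mathbf1}\}$; from $\Gamma\vdash e\colon\mathrm N_{\mathrm{norm}}$ infer $\Gamma\vdash(\mathsf d\,e)\colon\mathrm N_{\mathrm{norm}}$; from $\Gamma_0\vdash e_0\colon\mathrm N_{\mathrm{safe}}$, $\Gamma_1\vdash e_1\colon\mathrm N_{\mathrm{safe}}$ infer $\Gamma_0\cup\Gamma_1\vdash(\mathsf{down}\,e_0\,e_1)\colon\mathrm N_{\mathrm{safe}}$; from $\Gamma_i\vdash e_i\colon\mathrm N_{\mathrm{safe}}$ ($i=0,1,2$) infer $\Gamma_0\cup\Gamma_1\cup\Gamma_2\vdash(\mathsf{If}\,e_0\,\mathsf{then}\,e_1\,\mathsf{else}\,e_2)\colon\mathrm N_{\mathrm{safe}}$; subsumption (from $\Gamma\vdash e\colon\sigma$ and $\sigma<:\tau$ infer $\Gamma\vdash e\colon\tau$); from $\Gamma\vdash e\colon\mathrm N_{\mathrm{norm}}\to\mathrm N_{\mathrm{safe}}\to\mathrm N_{\mathrm{safe}}$ infer $\Gamma\vdash(\mathsf{prn}\,e)\colon\mathrm N_{\mathrm{norm}}\to\mathrm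 N_{\mathrm{safe}}$. Semantics (both base types denote $\{\mathbf0,\mathbf1\}^*$, call-by-value): $\mathsf c_{a}\,v=a\oplus v$; $\mathsf d(a\oplus v)=v$, $\mathsf d\,\epsilon=\epsilon$; $\mathsf t_a\,v=\mathbf 0$ if $v$ begins with $a$ and $\epsilon$ otherwise; $\mathsf{down}\,v_0\,v_1=v_0$ if $|v_0|\le|v_1|$ and $\epsilon$ otherwise; $\mathsf{If}\,v_0\,\mathsf{then}\,v_1\,\mathsf{else}\,v_2=v_1$ if $v_0\neq\epsilon$ and $v_2$ if $v_0=\epsilon$; $\mathsf{prn}\,f\,\epsilon=f\,\epsilon\,\epsilon$ and $\mathsf{prn}\,f\,(a\oplus y)=f\,(a\oplus y)\,(\mathsf{prn}\,f\,y)$ for $a\in\{\mathbf0,\mathbf1\}$. -}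

module Defs where

open import Data.Nat using (ℕ; zero; suc; _+_; _*_; _⊔_; _≟_)
open import Data.Fin using (Fin; zero; suc)
open import Data.List using (List; []; _∷_; length)
open import Data.Maybe using (Maybe; just; nothing)
open import Data.Product using (_×_)
open import Relation.Nullary using (yes; no)
open import Relation.Binary.PropositionalEquality using (_≡_; _≢_)

-- Strings over {0,1} (dyadic notation for naturals)

data Bit : Set where
  𝟎 𝟏 : Bit

Str : Set
Str = List Bit

∣_∣ : Str → ℕ
∣ v ∣ = length v

maxFin : ∀ {m} → (Fin m → ℕ) → ℕ
maxFin {zero}  f = 0
maxFin {suc m} f = f zero ⊔ maxFin (λ i → f (suc i))

data Poly (m : ℕ) : Set where
  cst  : ℕ → Poly m
  pvar : Fin m → Poly m
  _⊕_  : Poly m → Poly m → Poly m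
  _⊗_  : Poly m → Poly m → Poly m

⟦_⟧ₚ : ∀ {m} → Poly m → (Fin m → ℕ) → ℕ
⟦ cst k  ⟧ₚ a = k
⟦ pvar i ⟧ₚ a = a i
⟦ p ⊕ q  ⟧ₚ a = ⟦ p ⟧ₚ a + ⟦ q ⟧ₚ a
⟦ p ⊗ q  ⟧ₚ a = ⟦ p ⟧ₚ a * ⟦ q ⟧ₚ a

Var : Set
Var = ℕ

data Exp : Set where
  const : Str → Exp
  c     : Bit → Exp → Exp
  d     : Exp → Exp
  t     : Bit → Exp → Exp
  down  : Exp → Exp → Exp
  var   : Var → Exp
  app   : Exp → Exp → Exp
  lam   : Var → Exp → Exp
  ite   : Exp → Exp → Exp → Exp
  prn   : Exp → Exp

-- Types: level-0 and level-1 simple types over N_norm, N_safe.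
-- Level ≤ 1 types are exactly  b₁ → … → b_k → b  (base domains).

data Base : Set where
  norm safe : Base

data Ty : Set where
  base : Base → Ty
  _⇒_  : Base → Ty → Ty

infixr 20 _⇒_

data _<:ᵇ_ : Base → Base → Set where
  <:-refl : ∀ {b} → b <:ᵇ b
  norm<:safe : norm <:ᵇ safe

data _<:_ : Ty → Ty → Set where
  base<: : ∀ {b b'} → b <:ᵇ b' → base b <: base b'
  arr<:  : ∀ {σ₀ σ₁ τ₀ τ₁} → σ₁ <:ᵇ σ₀ → τ₀ <: τ₁ → (σ₀ ⇒ τ₀) <: (σ₁ ⇒ τ₁)

Ctx : Set
Ctx = Var → Maybe Base

_,_∶_ : Ctx → Var → Base → Ctx
(Γ , x ∶ b) z with z ≟ x
... | yes _ = just b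
... | no  _ = Γ z

Consistent : Ctx → Ctx → Set
Consistent Γ₀ Γ₁ = ∀ z {b₀ b₁} → Γ₀ z ≡ just b₀ → Γ₁ z ≡ just b₁ → b₀ ≡ b₁

_∪_ : Ctx → Ctx → Ctx
(Γ₀ ∪ Γ₁) z with Γ₀ z
... | just b  = just b
... | nothing = Γ₁ z

IsUnion : Ctx → Ctx → Ctx → Set
IsUnion Γ₀ Γ₁ Γ = Consistent Γ₀ Γ₁ × (∀ z → Γ z ≡ (Γ₀ ∪ Γ₁) z)

data _⊢_∶_ : Ctx → Exp → Ty → Set where
  ty-var  : ∀ {Γ x b} → Γ x ≡ just b → Γ ⊢ var x ∶ base b
  ty-lam  : ∀ {Γ x σ e τ} → (Γ , x ∶ σ) ⊢ e ∶ τ → Γ ⊢ lam x e ∶ (σ ⇒ τ)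
  ty-app  : ∀ {Γ₀ Γ₁ Γ e₀ e₁ σ τ} → Γ₀ ⊢ e₀ ∶ (σ ⇒ τ) → Γ₁ ⊢ e₁ ∶ base σ →
            IsUnion Γ₀ Γ₁ Γ → Γ ⊢ app e₀ e₁ ∶ τ
  ty-const : ∀ {Γ k} → Γ ⊢ const k ∶ base safe
  ty-eps   : ∀ {Γ} → Γ ⊢ const [] ∶ base norm
  ty-c    : ∀ {Γ a e} → Γ ⊢ e ∶ base safe → Γ ⊢ c a e ∶ base safe
  ty-d    : ∀ {Γ e} → Γ ⊢ e ∶ base safe → Γ ⊢ d e ∶ base safe
  ty-t    : ∀ {Γ a e} → Γ ⊢ e ∶ base safe → Γ ⊢ t a e ∶ base safe
  ty-dn   : ∀ {Γ e} → Γ ⊢ e ∶ base norm → Γ ⊢ d e ∶ base norm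
  ty-down : ∀ {Γ₀ Γ₁ Γ e₀ e₁} → Γ₀ ⊢ e₀ ∶ base safe → Γ₁ ⊢ e₁ ∶ base safe →
            IsUnion Γ₀ Γ₁ Γ → Γ ⊢ down e₀ e₁ ∶ base safe
  ty-ite  : ∀ {Γ₀ Γ₁ Γ₂ Γ₀₁ Γ e₀ e₁ e₂} →
            Γ₀ ⊢ e₀ ∶ base safe → Γ₁ ⊢ e₁ ∶ base safe → Γ₂ ⊢ e₂ ∶ base safe →
            IsUnion Γ₀ Γ₁ Γ₀₁ → IsUnion Γ₀₁ Γ₂ Γ → Γ ⊢ ite e₀ e₁ e₂ ∶ base safe
  ty-sub  : ∀ {Γ e σ τ} → Γ ⊢ e ∶ σ → σ <: τ → Γ ⊢ e ∶ τ
  ty-prn  : ∀ {Γ e} → Γ ⊢ e ∶ (norm ⇒ safe ⇒ base safe) → Γ ⊢ prn e ∶ (norm ⇒ base safe)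

-- Call-by-value big-step semantics.  Variables have base type, so
-- environments map variables to strings.

Env : Set
Env = Var → Str

_[_↦_] : Env → Var → Str → Env
(ρ [ x ↦ s ]) z with z ≟ x
... | yes _ = s
... | no  _ = ρ z

data Val : Set where
  str  : Str → Val
  clo  : Env → Var → Exp → Val
  prnv : Val → Val

dF : Str → Str
dF []      = []
dF (_ ∷ v) = v

tF : Bit → Str → Str
tF 𝟎 (𝟎 ∷ v) = 𝟎 ∷ []
tF 𝟏 (𝟏 ∷ v) = 𝟎 ∷ []
tF _ _       = []

downF : Str → Str → Str
downF v₀ v₁ with length v₀ Data.Nat.≤? length v₁
... | yes _ = v₀
... | no  _ = []

mutual
  data _⊢_⇓_ : Env → Exp → Val → Set where
    ev-const : ∀ {ρ k} → ρ ⊢ const k ⇓ str k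
    ev-var   : ∀ {ρ x} → ρ ⊢ var x ⇓ str (ρ x)
    ev-c     : ∀ {ρ a e v} → ρ ⊢ e ⇓ str v → ρ ⊢ c a e ⇓ str (a ∷ v)
    ev-d     : ∀ {ρ e v} → ρ ⊢ e ⇓ str v → ρ ⊢ d e ⇓ str (dF v)
    ev-t     : ∀ {ρ a e v} → ρ ⊢ e ⇓ str v → ρ ⊢ t a e ⇓ str (tF a v)
    ev-down  : ∀ {ρ e₀ e₁ v₀ v₁} → ρ ⊢ e₀ ⇓ str v₀ → ρ ⊢ e₁ ⇓ str v₁ →
               ρ ⊢ down e₀ e₁ ⇓ str (downF v₀ v₁)
    ev-ite-t : ∀ {ρ e₀ e₁ e₂ v₀ w} → ρ ⊢ e₀ ⇓ str v₀ → v₀ ≢ [] → ρ ⊢ e₁ ⇓ w →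
               ρ ⊢ ite e₀ e₁ e₂ ⇓ w
    ev-ite-f : ∀ {ρ e₀ e₁ e₂ w} → ρ ⊢ e₀ ⇓ str [] → ρ ⊢ e₂ ⇓ w →
               ρ ⊢ ite e₀ e₁ e₂ ⇓ w
    ev-lam   : ∀ {ρ x e} → ρ ⊢ lam x e ⇓ clo ρ x e
    ev-app   : ∀ {ρ e₀ e₁ f u w} → ρ ⊢ e₀ ⇓ f → ρ ⊢ e₁ ⇓ u → Apply f u w →
               ρ ⊢ app e₀ e₁ ⇓ w
    ev-prn   : ∀ {ρ e f} → ρ ⊢ e ⇓ f → ρ ⊢ prn e ⇓ prnv f

  data Apply : Val → Val → Val → Set where
    ap-clo    : ∀ {ρ x e s w} → (ρ [ x ↦ s ]) ⊢ e ⇓ w → Apply (clo ρ x e) (str s) w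
    ap-prn-ε  : ∀ {f g w} → Apply f (str []) g → Apply g (str []) w →
                Apply (prnv f) (str []) w
    ap-prn-∷  : ∀ {f a y r g w} → Apply (prnv f) (str y) r →
                Apply f (str (a ∷ y)) g → Apply g r w →
                Apply (prnv f) (str (a ∷ y)) w

-- A logical relation: a value is Bounded at type τ by a univariate polynomial
-- q at (n , s) when at N_norm it is a string of length ≤ n, at N_safe one of
-- length ≤ q(n) + s, and at an arrow type its applications are bounded at the
-- codomain once the argument length is absorbed by max into n (normal
-- argument) or s (safe argument). By induction on typing, every well-typed
-- expression has a q such that its value is bounded by q at (n , s) whenever
-- the normal variables have length ≤ n and the safe ones length ≤ s. Safe
-- inputs thus only ever enter additively; the decisive case is prn, whose
-- |y| + 1 unfoldings multiply the step function's bound by at most 1 + n.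
-- Bounding the maximum n of the normal inputs by their sum finally turns
-- q(n) into a polynomial in the normal inputs.
module Submission where

open import Defs
open import Data.Nat using (ℕ; _≤_; _+_)
open import Data.Fin using (Fin)
open import Data.Maybe using (just)
open import Data.Product using (_×_; Σ; ∃)
open import Data.Sum using (_⊎_)
open import Relation.Binary.PropositionalEquality using (_≡_)
open import Function using (Injective)

open import Data.Nat using (zero; suc; _*_; _⊔_; _≟_; _≤?_; z≤n; s≤s)
open import Data.Nat.Properties
open import Algebra.Properties.CommutativeSemigroup +-commutativeSemigroup using (x∙yz≈xz∙y)
open import Data.Fin using (zero; suc)
open import Data.Maybe using (nothing)
open import Data.List using ([]; _∷_; length)
open import Data.Product using (_,_; proj₂)
open import Data.Sum using (inj₁; inj₂)
open import Relation.Nullary using (yes; no)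
open import Relation.Binary.PropositionalEquality using (refl; sym; cong; cong₂)

⟦_⟧₁ : Poly 1 → ℕ → ℕ
⟦ q ⟧₁ k = ⟦ q ⟧ₚ (λ _ → k)

⟦⟧₁-mono : ∀ q {k l} → k ≤ l → ⟦ q ⟧₁ k ≤ ⟦ q ⟧₁ l
⟦⟧₁-mono (cst _)  _   = ≤-refl
⟦⟧₁-mono (pvar _) k≤l = k≤l
⟦⟧₁-mono (p ⊕ q)  k≤l = +-mono-≤ (⟦⟧₁-mono p k≤l) (⟦⟧₁-mono q k≤l)
⟦⟧₁-mono (p ⊗ q)  k≤l = *-mono-≤ (⟦⟧₁-mono p k≤l) (⟦⟧₁-mono q k≤l)

data Within (k : ℕ) : Val → Set where
  within : ∀ {v} → ∣ v ∣ ≤ k → Within k (str v)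

Within⇒≤ : ∀ {k v} → Within k (str v) → ∣ v ∣ ≤ k
Within⇒≤ (within v≤k) = v≤k

Within-mono : ∀ {k l w} → k ≤ l → Within k w → Within l w
Within-mono k≤l (within v≤k) = within (≤-trans v≤k k≤l)

Within-shrink : ∀ {k v} (f : Str → Str) → (∀ u → ∣ f u ∣ ≤ ∣ u ∣) →
                Within k (str v) → Within k (str (f v))
Within-shrink f shrinks (within v≤k) = within (≤-trans (shrinks _) v≤k)

∣dF∣≤ : ∀ v → ∣ dF v ∣ ≤ ∣ v ∣
∣dF∣≤ []      = z≤n
∣dF∣≤ (_ ∷ v) = n≤1+n _

∣tF∣≤1 : ∀ a v → ∣ tF a v ∣ ≤ 1
∣tF∣≤1 𝟎 (𝟎 ∷ _) = ≤-refl
∣tF∣≤1 𝟎 (𝟏 ∷ _) = z≤n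
∣tF∣≤1 𝟏 (𝟎 ∷ _) = z≤n
∣tF∣≤1 𝟏 (𝟏 ∷ _) = ≤-refl
∣tF∣≤1 𝟎 []      = z≤n
∣tF∣≤1 𝟏 []      = z≤n

∣downF∣≤ : ∀ v₀ v₁ → ∣ downF v₀ v₁ ∣ ≤ ∣ v₁ ∣
∣downF∣≤ v₀ v₁ with length v₀ ≤? length v₁
... | yes v₀≤v₁ = v₀≤v₁
... | no  _     = z≤n

Bounded : Ty → ℕ → ℕ → Poly 1 → Val → Set
Bounded (base norm) n s q = Within n
Bounded (base safe) n s q = Within (⟦ q ⟧₁ n + s)
Bounded (norm ⇒ τ) n s q f = ∀ {u g} → Apply f (str u) g → Bounded τ (n ⊔ ∣ u ∣) s q g
Bounded (safe ⇒ τ) n s q f = ∀ {u g} → Apply f (str u) g → Bounded τ n (s ⊔ ∣ u ∣) q g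

<:-refl′ : ∀ τ → τ <: τ
<:-refl′ (base _) = base<: <:-refl
<:-refl′ (_ ⇒ τ)  = arr<: <:-refl (<:-refl′ τ)

-- The extra summand p absorbs both the growth of the bounds and, through
-- k ≤ p(k), the promotion of normal values to safe ones.
Bounded-weaken : ∀ {σ τ} → σ <: τ → ∀ q p → (∀ k → k ≤ ⟦ p ⟧₁ k) →
                 ∀ {n s n′ s′ w} → n ≤ n′ → s ≤ s′ + ⟦ p ⟧₁ n′ →
                 Bounded σ n s q w → Bounded τ n′ s′ (q ⊕ p) w
Bounded-weaken (base<: (<:-refl {norm})) q p _ n≤n′ _ = Within-mono n≤n′
Bounded-weaken (base<: (<:-refl {safe})) q p _ {n′ = n′} {s′} n≤n′ s≤ =
  Within-mono (≤-trans (+-mono-≤ (⟦⟧₁-mono q n≤n′) s≤)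
                       (≤-reflexive (x∙yz≈xz∙y (⟦ q ⟧₁ n′) s′ (⟦ p ⟧₁ n′))))
Bounded-weaken (base<: norm<:safe) q p id≤p {n′ = n′} n≤n′ _ =
  Within-mono (≤-trans n≤n′ (≤-trans (id≤p n′) (m≤n⇒m≤n+o _ (m≤n+m _ (⟦ q ⟧₁ n′)))))
Bounded-weaken (arr<: (<:-refl {norm}) τ₀<:τ₁) q p id≤p {n′ = n′} {s′} n≤n′ s≤ h ap =
  Bounded-weaken τ₀<:τ₁ q p id≤p (⊔-monoˡ-≤ _ n≤n′)
    (≤-trans s≤ (+-monoʳ-≤ s′ (⟦⟧₁-mono p (m≤m⊔n n′ _)))) (h ap)
Bounded-weaken (arr<: (<:-refl {safe}) τ₀<:τ₁) q p id≤p {s′ = s′} n≤n′ s≤ h ap =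
  Bounded-weaken τ₀<:τ₁ q p id≤p n≤n′
    (⊔-lub (≤-trans s≤ (+-monoˡ-≤ _ (m≤m⊔n s′ _))) (m≤n⇒m≤n+o _ (m≤n⊔m s′ _))) (h ap)
Bounded-weaken (arr<: norm<:safe τ₀<:τ₁) q p id≤p {n′ = n′} {s′} n≤n′ s≤ h ap =
  Bounded-weaken τ₀<:τ₁ q p id≤p (m≤n⇒m≤n⊔o _ n≤n′)
    (⊔-lub (≤-trans s≤ (+-monoʳ-≤ s′ (⟦⟧₁-mono p (m≤m⊔n n′ _))))
           (≤-trans (m≤n⊔m n′ _) (≤-trans (id≤p _) (m≤n+m _ s′))))
    (h ap)

Bounded-apply-norm : ∀ τ q {n s f u g} → Bounded (norm ⇒ τ) n s q f → Within n u →
                     Apply f u g → Bounded τ n s (q ⊕ pvar zero) g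
Bounded-apply-norm τ q h (within u≤n) ap =
  Bounded-weaken (<:-refl′ τ) q (pvar zero) (λ _ → ≤-refl) (⊔-lub ≤-refl u≤n) (m≤m+n _ _) (h ap)

Bounded-apply-safe : ∀ τ q r {n s f u g} → Bounded (safe ⇒ τ) n s q f →
                     Within (⟦ r ⟧₁ n + s) u → Apply f u g → Bounded τ n s (q ⊕ (r ⊕ pvar zero)) g
Bounded-apply-safe τ q r {n} {s} h (within u≤) ap =
  Bounded-weaken (<:-refl′ τ) q (r ⊕ pvar zero) (λ k → m≤n+m k _) ≤-refl
    (⊔-lub (m≤m+n s _)
           (≤-trans u≤ (≤-trans (≤-reflexive (+-comm _ s)) (+-monoʳ-≤ s (m≤m+n _ n)))))
    (h ap)

-- Unfolding prn f y gives |y| + 1 nested applications of f, each adding at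
-- most q(N) to the safe bound.
Bounded-prn : ∀ {n s q f N} → Bounded (norm ⇒ safe ⇒ base safe) n s q f →
              ∀ y {w} → n ⊔ ∣ y ∣ ≤ N → Apply (prnv f) (str y) w →
              Within (suc ∣ y ∣ * ⟦ q ⟧₁ N + s) w
Bounded-prn {s = s} {q} hf [] n≤N (ap-prn-ε a₁ a₂) =
  Within-mono (+-mono-≤ (≤-trans (⟦⟧₁-mono q n≤N) (m≤m+n _ 0)) (≤-reflexive (⊔-identityʳ s)))
              (hf a₁ a₂)
Bounded-prn {n} {s} {q} {f} {N} hf (_ ∷ y) n⊔y≤N (ap-prn-∷ ar af ag)
  with Bounded-prn {n} {s} {q} {f} {N} hf y (≤-trans (⊔-monoʳ-≤ n (n≤1+n _)) n⊔y≤N) ar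
... | within r≤ =
  Within-mono (≤-trans (+-mono-≤ (⟦⟧₁-mono q n⊔y≤N) (⊔-lub (m≤n+m s _) r≤))
                       (≤-reflexive (sym (+-assoc (⟦ q ⟧₁ N) _ s))))
              (hf af ag)

_⊆_ : Ctx → Ctx → Set
Δ ⊆ Δ′ = ∀ z {b} → Δ z ≡ just b → Δ′ z ≡ just b

IsUnion⇒⊆ˡ : ∀ {Γ₀ Γ₁ Γ} → IsUnion Γ₀ Γ₁ Γ → Γ₀ ⊆ Γ
IsUnion⇒⊆ˡ (_ , Γ≡) z Γ₀z≡ rewrite Γ≡ z | Γ₀z≡ = refl

IsUnion⇒⊆ʳ : ∀ {Γ₀ Γ₁ Γ} → IsUnion Γ₀ Γ₁ Γ → Γ₁ ⊆ Γ
IsUnion⇒⊆ʳ {Γ₀} (consistent , Γ≡) z Γ₁z≡ rewrite Γ≡ z with Γ₀ z in Γ₀z≡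
... | just _  = cong just (consistent z Γ₀z≡ Γ₁z≡)
... | nothing = Γ₁z≡

record Bounds (Δ : Ctx) (ρ : Env) (n s : ℕ) : Set where
  constructor _,_
  field
    norm≤ : ∀ z → Δ z ≡ just norm → ∣ ρ z ∣ ≤ n
    safe≤ : ∀ z → Δ z ≡ just safe → ∣ ρ z ∣ ≤ s

Bounds-⊆ : ∀ {Δ Δ′ ρ n s} → Δ ⊆ Δ′ → Bounds Δ′ ρ n s → Bounds Δ ρ n s
Bounds-⊆ Δ⊆Δ′ (norm≤ , safe≤) = (λ z h → norm≤ z (Δ⊆Δ′ z h)) , (λ z h → safe≤ z (Δ⊆Δ′ z h))

Bounds-extend-norm : ∀ {Δ ρ n s x u} → Bounds Δ ρ n s →
                     Bounds (Δ , x ∶ norm) (ρ [ x ↦ u ]) (n ⊔ ∣ u ∣) s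
Bounds-extend-norm {Δ} {ρ} {n} {s} {x} {u} (norm≤ , safe≤) = norm≤′ , safe≤′
  where
  norm≤′ : ∀ z → (Δ , x ∶ norm) z ≡ just norm → ∣ (ρ [ x ↦ u ]) z ∣ ≤ n ⊔ ∣ u ∣
  norm≤′ z h with z ≟ x
  ... | yes _ = m≤n⊔m n _
  ... | no  _ = m≤n⇒m≤n⊔o _ (norm≤ z h)
  safe≤′ : ∀ z → (Δ , x ∶ norm) z ≡ just safe → ∣ (ρ [ x ↦ u ]) z ∣ ≤ s
  safe≤′ z h with z ≟ x
  safe≤′ z () | yes _
  ...         | no  _ = safe≤ z h

Bounds-extend-safe : ∀ {Δ ρ n s x u} → Bounds Δ ρ n s →
                     Bounds (Δ , x ∶ safe) (ρ [ x ↦ u ]) n (s ⊔ ∣ u ∣)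
Bounds-extend-safe {Δ} {ρ} {n} {s} {x} {u} (norm≤ , safe≤) = norm≤′ , safe≤′
  where
  norm≤′ : ∀ z → (Δ , x ∶ safe) z ≡ just norm → ∣ (ρ [ x ↦ u ]) z ∣ ≤ n
  norm≤′ z h with z ≟ x
  norm≤′ z () | yes _
  ...         | no  _ = norm≤ z h
  safe≤′ : ∀ z → (Δ , x ∶ safe) z ≡ just safe → ∣ (ρ [ x ↦ u ]) z ∣ ≤ s ⊔ ∣ u ∣
  safe≤′ z h with z ≟ x
  ... | yes _ = m≤n⊔m s _
  ... | no  _ = m≤n⇒m≤n⊔o _ (safe≤ z h)

Valid : Ctx → Exp → Ty → Poly 1 → Set
Valid Δ e τ q = ∀ {ρ n s w} → Bounds Δ ρ n s → ρ ⊢ e ⇓ w → Bounded τ n s q w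

fundamental : ∀ {Δ e τ} → Δ ⊢ e ∶ τ → Σ (Poly 1) (Valid Δ e τ)
fundamental (ty-var {x = x} {b = norm} Δx≡) = cst 0 , λ { (norm≤ , _) ev-var → within (norm≤ x Δx≡) }
fundamental (ty-var {x = x} {b = safe} Δx≡) = cst 0 , λ { (_ , safe≤) ev-var → within (safe≤ x Δx≡) }
fundamental (ty-lam {σ = norm} ⊢e) with fundamental ⊢e
... | q , valid = q , λ { bounds ev-lam (ap-clo ⇓w) → valid (Bounds-extend-norm bounds) ⇓w }
fundamental (ty-lam {σ = safe} ⊢e) with fundamental ⊢e
... | q , valid = q , λ { bounds ev-lam (ap-clo ⇓w) → valid (Bounds-extend-safe bounds) ⇓w }
fundamental (ty-app {σ = norm} {τ} ⊢e₀ ⊢e₁ union) with fundamental ⊢e₀ | fundamental ⊢e₁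
... | q₀ , valid₀ | _ , valid₁ = q₀ ⊕ pvar zero , λ { bounds (ev-app ⇓f ⇓u ap) →
  Bounded-apply-norm τ q₀ (valid₀ (Bounds-⊆ (IsUnion⇒⊆ˡ union) bounds) ⇓f)
                          (valid₁ (Bounds-⊆ (IsUnion⇒⊆ʳ union) bounds) ⇓u) ap }
fundamental (ty-app {σ = safe} {τ} ⊢e₀ ⊢e₁ union) with fundamental ⊢e₀ | fundamental ⊢e₁
... | q₀ , valid₀ | q₁ , valid₁ = q₀ ⊕ (q₁ ⊕ pvar zero) , λ { bounds (ev-app ⇓f ⇓u ap) →
  Bounded-apply-safe τ q₀ q₁ (valid₀ (Bounds-⊆ (IsUnion⇒⊆ˡ union) bounds) ⇓f)
                             (valid₁ (Bounds-⊆ (IsUnion⇒⊆ʳ union) bounds) ⇓u) ap }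
fundamental (ty-const {k = k}) = cst (length k) , λ { _ ev-const → within (m≤m+n _ _) }
fundamental ty-eps = cst 0 , λ { _ ev-const → within z≤n }
fundamental (ty-c ⊢e) with fundamental ⊢e
... | q , valid = cst 1 ⊕ q , λ { bounds (ev-c ⇓v) → Within-cons (valid bounds ⇓v) }
  where
  Within-cons : ∀ {k a v} → Within k (str v) → Within (suc k) (str (a ∷ v))
  Within-cons (within v≤k) = within (s≤s v≤k)
fundamental (ty-d ⊢e) with fundamental ⊢e
... | q , valid = q , λ { bounds (ev-d ⇓v) → Within-shrink dF ∣dF∣≤ (valid bounds ⇓v) }
fundamental (ty-dn ⊢e) with fundamental ⊢e
... | q , valid = q , λ { bounds (ev-d ⇓v) → Within-shrink dF ∣dF∣≤ (valid bounds ⇓v) }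
fundamental (ty-t {a = a} _) = cst 1 , λ { _ (ev-t {v = v} _) → within (m≤n⇒m≤n+o _ (∣tF∣≤1 a v)) }
fundamental (ty-down _ ⊢e₁ union) with fundamental ⊢e₁
... | q , valid = q , λ { bounds (ev-down {v₀ = v₀} _ ⇓v₁) →
  Within-shrink (downF v₀) (∣downF∣≤ v₀) (valid (Bounds-⊆ (IsUnion⇒⊆ʳ union) bounds) ⇓v₁) }
fundamental (ty-ite _ ⊢e₁ ⊢e₂ union₀₁ union) with fundamental ⊢e₁ | fundamental ⊢e₂
... | q₁ , valid₁ | q₂ , valid₂ = q₁ ⊕ q₂ , λ
  { {s = s} bounds (ev-ite-t _ _ ⇓w) →
      Within-mono (+-monoˡ-≤ s (m≤m+n _ _))
        (valid₁ (Bounds-⊆ (λ z h → IsUnion⇒⊆ˡ union z (IsUnion⇒⊆ʳ union₀₁ z h)) bounds) ⇓w)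
  ; {s = s} bounds (ev-ite-f _ ⇓w) →
      Within-mono (+-monoˡ-≤ s (m≤n+m _ _)) (valid₂ (Bounds-⊆ (IsUnion⇒⊆ʳ union) bounds) ⇓w) }
fundamental (ty-sub ⊢e σ<:τ) with fundamental ⊢e
... | q , valid = q ⊕ pvar zero , λ { {n = n} {s} bounds ⇓w →
  Bounded-weaken σ<:τ q (pvar zero) (λ _ → ≤-refl) ≤-refl (m≤m+n s n) (valid bounds ⇓w) }
fundamental (ty-prn ⊢f) with fundamental ⊢f
... | q , valid = (cst 1 ⊕ pvar zero) ⊗ q , λ { {n = n} {s} bounds (ev-prn ⇓f) {u} ap →
  Within-mono (+-monoˡ-≤ s (*-monoˡ-≤ _ (s≤s (m≤n⊔m n _))))
              (Bounded-prn {q = q} (valid bounds ⇓f) u ≤-refl ap) }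

_∘ₚ_ : ∀ {m} → Poly 1 → Poly m → Poly m
cst k  ∘ₚ _ = cst k
pvar _ ∘ₚ p = p
(q ⊕ r) ∘ₚ p = (q ∘ₚ p) ⊕ (r ∘ₚ p)
(q ⊗ r) ∘ₚ p = (q ∘ₚ p) ⊗ (r ∘ₚ p)

⟦∘ₚ⟧ : ∀ {m} q (p : Poly m) a → ⟦ q ∘ₚ p ⟧ₚ a ≡ ⟦ q ⟧₁ (⟦ p ⟧ₚ a)
⟦∘ₚ⟧ (cst _)  _ _ = refl
⟦∘ₚ⟧ (pvar _) _ _ = refl
⟦∘ₚ⟧ (q ⊕ r)  p a = cong₂ _+_ (⟦∘ₚ⟧ q p a) (⟦∘ₚ⟧ r p a)
⟦∘ₚ⟧ (q ⊗ r)  p a = cong₂ _*_ (⟦∘ₚ⟧ q p a) (⟦∘ₚ⟧ r p a)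

sumOf : ∀ {k m} → (Fin k → Fin m) → Poly m
sumOf {zero}  _ = cst 0
sumOf {suc k} g = pvar (g zero) ⊕ sumOf (λ i → g (suc i))

maxFin≤⟦sumOf⟧ : ∀ {k m} (g : Fin k → Fin m) a → maxFin (λ i → a (g i)) ≤ ⟦ sumOf g ⟧ₚ a
maxFin≤⟦sumOf⟧ {zero}  _ _ = z≤n
maxFin≤⟦sumOf⟧ {suc k} g a =
  ≤-trans (m⊔n≤m+n (a (g zero)) _) (+-monoʳ-≤ (a (g zero)) (maxFin≤⟦sumOf⟧ (λ i → g (suc i)) a))

⟦⟧₁-maxFin≤ : ∀ {m} q (a : Fin m → ℕ) → ⟦ q ⟧₁ (maxFin a) ≤ ⟦ q ∘ₚ sumOf (λ i → i) ⟧ₚ a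
⟦⟧₁-maxFin≤ q a = ≤-trans (⟦⟧₁-mono q (maxFin≤⟦sumOf⟧ (λ i → i) a))
                          (≤-reflexive (sym (⟦∘ₚ⟧ q (sumOf (λ i → i)) a)))

≤maxFin : ∀ {m} (f : Fin m → ℕ) i → f i ≤ maxFin f
≤maxFin f zero    = m≤m⊔n _ _
≤maxFin f (suc i) = m≤n⇒m≤o⊔n (f zero) (≤maxFin (λ j → f (suc j)) i)

Bounds-maxFin : ∀ {m n} (xs : Fin m → Var) (ys : Fin n → Var) {Γ} →
  (∀ z b → Γ z ≡ just b →
     (b ≡ norm × ∃ λ i → xs i ≡ z) ⊎ (b ≡ safe × ∃ λ j → ys j ≡ z)) →
  ∀ ρ → Bounds Γ ρ (maxFin (λ i → ∣ ρ (xs i) ∣)) (maxFin (λ j → ∣ ρ (ys j) ∣))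
Bounds-maxFin xs ys {Γ} Γ-vars ρ = norm≤ , safe≤
  where
  norm≤ : ∀ z → Γ z ≡ just norm → ∣ ρ z ∣ ≤ maxFin (λ i → ∣ ρ (xs i) ∣)
  norm≤ z Γz≡ with Γ-vars z norm Γz≡
  ... | inj₁ (_ , i , refl) = ≤maxFin (λ i → ∣ ρ (xs i) ∣) i
  ... | inj₂ (() , _)
  safe≤ : ∀ z → Γ z ≡ just safe → ∣ ρ z ∣ ≤ maxFin (λ j → ∣ ρ (ys j) ∣)
  safe≤ z Γz≡ with Γ-vars z safe Γz≡
  ... | inj₂ (_ , j , refl) = ≤maxFin (λ j → ∣ ρ (ys j) ∣) j
  ... | inj₁ (() , _)

proposition3p1 : (m n : ℕ) (xs : Fin m → Var) (ys : Fin n → Var) (Γ : Ctx) →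
    Injective _≡_ _≡_ xs → Injective _≡_ _≡_ ys →
    (∀ z b → Γ z ≡ just b →
       (b ≡ norm × ∃ λ i → xs i ≡ z) ⊎ (b ≡ safe × ∃ λ j → ys j ≡ z)) →
    (∀ i → Γ (xs i) ≡ just norm) → (∀ j → Γ (ys j) ≡ just safe) →
    (e : Exp) →
      (Γ ⊢ e ∶ base norm →
         ∀ (ρ : Env) (v : Str) → ρ ⊢ e ⇓ str v →
           ∣ v ∣ ≤ maxFin (λ i → ∣ ρ (xs i) ∣))
    × (Γ ⊢ e ∶ base safe →
         Σ (Poly m) λ p → ∀ (ρ : Env) (v : Str) → ρ ⊢ e ⇓ str v →
           ∣ v ∣ ≤ ⟦ p ⟧ₚ (λ i → ∣ ρ (xs i) ∣) + maxFin (λ j → ∣ ρ (ys j) ∣))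
proposition3p1 m n xs ys Γ _ _ Γ-vars _ _ e = normBound , safeBound
  where
  inputs : ∀ ρ → Bounds Γ ρ (maxFin (λ i → ∣ ρ (xs i) ∣)) (maxFin (λ j → ∣ ρ (ys j) ∣))
  inputs = Bounds-maxFin xs ys Γ-vars
  normBound : Γ ⊢ e ∶ base norm → ∀ ρ v → ρ ⊢ e ⇓ str v → ∣ v ∣ ≤ maxFin (λ i → ∣ ρ (xs i) ∣)
  normBound ⊢e ρ v ⇓v = Within⇒≤ (proj₂ (fundamental ⊢e) (inputs ρ) ⇓v)
  safeBound : Γ ⊢ e ∶ base safe → Σ (Poly m) λ p → ∀ ρ v → ρ ⊢ e ⇓ str v →
              ∣ v ∣ ≤ ⟦ p ⟧ₚ (λ i → ∣ ρ (xs i) ∣) + maxFin (λ j → ∣ ρ (ys j) ∣)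
  safeBound ⊢e with fundamental ⊢e
  ... | q , valid = q ∘ₚ sumOf (λ i → i) , λ ρ v ⇓v →
    ≤-trans (Within⇒≤ (valid (inputs ρ) ⇓v)) (+-monoˡ-≤ _ (⟦⟧₁-maxFin≤ q (λ i → ∣ ρ (xs i) ∣)))
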